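{- Let $\delta=2+\sqrt[3]{2}$. For all $b,c>0$ with $3\le cb\le\delta$, the optimal solution of the program $$\min_{s,r\in\mathbb{R}} \; s^2+r^2 \quad\text{s.t.}\quad \frac1s+\frac2r\le c,\qquad 0\le s,r\le b$$ is $s=\frac{b}{bc-2}$, $r=b$. -}

module Defs where

open import Data.Product using (Σ; _×_; _,_)
open import Relation.Binary.PropositionalEquality using (_≡_)
open import Relation.Nullary using (¬_)
open import Algebra.Structures using (IsCommutativeRing)
open import Relation.Binary.Structures using (IsDecTotalOrder)

-- Equality is propositional equality on the carrier;
-- the order is a decidable total order (as for ℝ classically);
-- the multiplicative inverse is total with the convention that it is
-- only specified on non-zero arguments.
record RealField : Set₁ where
  infixl 6 _+_ _-_
  infixl 7 _*_
  infix  4 _≤_ _<_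
  field
    ℝ     : Set
    _+_   : ℝ → ℝ → ℝ
    _*_   : ℝ → ℝ → ℝ
    -_    : ℝ → ℝ
    0ℝ    : ℝ
    1ℝ    : ℝ
    _⁻¹   : ℝ → ℝ
    _≤_   : ℝ → ℝ → Set
    isCommutativeRing : IsCommutativeRing _≡_ _+_ _*_ -_ 0ℝ 1ℝ
    isDecTotalOrder   : IsDecTotalOrder _≡_ _≤_
    0≢1     : ¬ (0ℝ ≡ 1ℝ)
    ⁻¹-inverse : ∀ x → ¬ (x ≡ 0ℝ) → x * (x ⁻¹) ≡ 1ℝ
    +-mono-≤   : ∀ x y z → x ≤ y → x + z ≤ y + z
    *-nonneg   : ∀ x y → 0ℝ ≤ x → 0ℝ ≤ y → 0ℝ ≤ x * y
    complete : (P : ℝ → Set) → Σ ℝ P → Σ ℝ (λ u → ∀ x → P x → x ≤ u) →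
               Σ ℝ (λ l → (∀ x → P x → x ≤ l) ×
                          (∀ u → (∀ x → P x → x ≤ u) → l ≤ u))

  _<_ : ℝ → ℝ → Set
  x < y = x ≤ y × ¬ (x ≡ y)

  _-_ : ℝ → ℝ → ℝ
  x - y = x + (- y)

  _/_ : ℝ → ℝ → ℝ
  x / y = x * (y ⁻¹)

  2ℝ 3ℝ : ℝ
  2ℝ = 1ℝ + 1ℝ
  3ℝ = 2ℝ + 1ℝ

  -- feasible set of the program:  1/s + 2/r ≤ c,  0 ≤ s,r ≤ b
  -- (s, r > 0 is needed for 1/s, 2/r to make sense)
  Feasible : (b c s r : ℝ) → Set
  Feasible b c s r =
    (0ℝ < s) × (0ℝ < r) × (s ≤ b) × (r ≤ b) × ((1ℝ / s) + (2ℝ / r) ≤ c)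

  objective : ℝ → ℝ → ℝ
  objective s r = s * s + r * r

  IsUniqueMinimizer : (b c s₀ r₀ : ℝ) → Set
  IsUniqueMinimizer b c s₀ r₀ =
    Feasible b c s₀ r₀ ×
    (∀ s r → Feasible b c s r → objective s₀ r₀ ≤ objective s r) ×
    (∀ s r → Feasible b c s r → objective s r ≤ objective s₀ r₀ →
       (s ≡ s₀) × (r ≡ r₀))

-- The candidate A = b/(bc − 2) meets the constraint 1/s + 2/r ≤ c with equality.
-- Since 1/t lies above its tangent lines, the constraint implies its linearisation
-- at (A, b); weighting that by the Lagrange multiplier 2A³ and adding the bound
-- r ≤ b, whose multiplier is nonnegative exactly because (bc − 2)³ ≤ 2, gives
-- A² + b² ≤ As + br for every feasible (s, r).  By AM-GM this forces
-- s² + r² ≥ A² + b², with equality only at (s, r) = (A, b).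
module Submission where

open import Defs
open import Algebra.Bundles using (CommutativeRing)
open import Data.Product using (_×_; _,_; proj₁)
open import Data.Sum using (inj₁; inj₂)
open import Relation.Binary.PropositionalEquality
open import Relation.Binary.Bundles using (Poset)
import Relation.Binary.Reasoning.PartialOrder
open import Relation.Binary.Structures using (IsDecTotalOrder)
open import Relation.Nullary using (¬_; yes; no)

module OrderedField (R : RealField) where
  open RealField R

  commutativeRing : CommutativeRing _ _
  commutativeRing = record { isCommutativeRing = isCommutativeRing }

  open CommutativeRing commutativeRing public
    using ( commutativeSemiring; +-assoc; +-comm; *-assoc; *-comm
          ; +-identityˡ; +-identityʳ; *-identityˡ; *-identityʳ; zeroˡ; zeroʳ
          ; -‿inverseʳ; distribˡ; distribʳ )
  open import Algebra.Properties.Ring (CommutativeRing.ring commutativeRing)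
    using (-‿distribˡ-*; -‿distribʳ-*)
  open import Algebra.Properties.Group (CommutativeRing.+-group commutativeRing) public
    using (//-rightDividesˡ; //-rightDividesʳ; ⁻¹-involutive)
  open import Algebra.Properties.CommutativeSemigroup
    (CommutativeRing.+-commutativeSemigroup commutativeRing) public
    using ()
    renaming ( interchange to +-interchange
             ; xy∙z≈xz∙y to x+y+z≡x+z+y
             ; xy∙z≈x∙zy to x+y+z≡x+[z+y] )
  open import Algebra.Properties.CommutativeSemigroup
    (CommutativeRing.*-commutativeSemigroup commutativeRing) public
    using () renaming (xy∙z≈y∙xz to x*y*z≡y*[x*z])
  open import Algebra.Solver.Ring.NaturalCoefficients.Default commutativeSemiring public
    using (solve; _:=_; _:+_; _:*_; con)
  open IsDecTotalOrder isDecTotalOrder public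
    using (_≟_)
    renaming ( refl to ≤-refl; reflexive to ≤-reflexive; trans to ≤-trans
             ; antisym to ≤-antisym; total to ≤-total )

  ≤-poset : Poset _ _ _
  ≤-poset = record { isPartialOrder = IsDecTotalOrder.isPartialOrder isDecTotalOrder }

  module ≤-Reasoning = Relation.Binary.Reasoning.PartialOrder ≤-poset

  x-y+y≡x : ∀ x y → x - y + y ≡ x
  x-y+y≡x x y = //-rightDividesˡ y x

  x+[y-x]≡y : ∀ x y → x + (y - x) ≡ y
  x+[y-x]≡y x y = trans (+-comm x (y - x)) (x-y+y≡x y x)

  x+y-x≡y : ∀ x y → x + y - x ≡ y
  x+y-x≡y x y = trans (cong (_- x) (+-comm x y)) (//-rightDividesʳ x y)

  [x+y]+[x+y]≡2x+2y : ∀ x y → (x + y) + (x + y) ≡ 2ℝ * x + 2ℝ * y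
  [x+y]+[x+y]≡2x+2y = solve 2 (λ x y → (x :+ y) :+ (x :+ y) := con 2 :* x :+ con 2 :* y) refl

  *-oneʳ : ∀ {u} x → u ≡ 1ℝ → x * u ≡ x
  *-oneʳ x refl = *-identityʳ x

  u≡1⇒u*u≡1 : ∀ {u} → u ≡ 1ℝ → u * u ≡ 1ℝ
  u≡1⇒u*u≡1 refl = *-identityˡ 1ℝ

  u≡1⇒u*u*u≡1 : ∀ {u} → u ≡ 1ℝ → u * u * u ≡ 1ℝ
  u≡1⇒u*u*u≡1 refl = trans (*-identityʳ (1ℝ * 1ℝ)) (*-identityˡ 1ℝ)

  x≤y⇒0≤y-x : ∀ {x y} → x ≤ y → 0ℝ ≤ y - x
  x≤y⇒0≤y-x {x} {y} x≤y = subst (_≤ y - x) (-‿inverseʳ x) (+-mono-≤ x y (- x) x≤y)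

  +-monoʳ-≤ : ∀ z {x y} → x ≤ y → z + x ≤ z + y
  +-monoʳ-≤ z {x} {y} x≤y = subst₂ _≤_ (+-comm x z) (+-comm y z) (+-mono-≤ x y z x≤y)

  +-mono-≤₂ : ∀ {x y z w} → x ≤ y → z ≤ w → x + z ≤ y + w
  +-mono-≤₂ {x} {y} {z} x≤y z≤w = ≤-trans (+-mono-≤ x y z x≤y) (+-monoʳ-≤ y z≤w)

  +-cancelʳ-≤ : ∀ z {x y} → x + z ≤ y + z → x ≤ y
  +-cancelʳ-≤ z {x} {y} le =
    subst₂ _≤_ (//-rightDividesʳ z x) (//-rightDividesʳ z y) (+-mono-≤ _ _ (- z) le)

  +-cancelˡ-≤ : ∀ z {x y} → z + x ≤ z + y → x ≤ y
  +-cancelˡ-≤ z {x} {y} le = +-cancelʳ-≤ z (subst₂ _≤_ (+-comm z x) (+-comm z y) le)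

  x≤x+y : ∀ {x y} → 0ℝ ≤ y → x ≤ x + y
  x≤x+y {x} 0≤y = subst (_≤ x + _) (+-identityʳ x) (+-monoʳ-≤ x 0≤y)

  x+y≤u+v∧v≤y⇒x≤u : ∀ {x y u v} → x + y ≤ u + v → v ≤ y → x ≤ u
  x+y≤u+v∧v≤y⇒x≤u {u = u} le v≤y = +-cancelʳ-≤ _ (≤-trans le (+-monoʳ-≤ u v≤y))

  x+y≤x⇒y≤0 : ∀ {x y} → x + y ≤ x → y ≤ 0ℝ
  x+y≤x⇒y≤0 {x} {y} le = +-cancelˡ-≤ x (subst (x + y ≤_) (sym (+-identityʳ x)) le)

  *-monoˡ-≤-nonNeg : ∀ {z} → 0ℝ ≤ z → ∀ {x y} → x ≤ y → z * x ≤ z * y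
  *-monoˡ-≤-nonNeg {z} 0≤z {x} {y} x≤y =
    subst (z * x ≤_) zx+z[y-x]≡zy (x≤x+y (*-nonneg z (y - x) 0≤z (x≤y⇒0≤y-x x≤y)))
    where
    zx+z[y-x]≡zy : z * x + z * (y - x) ≡ z * y
    zx+z[y-x]≡zy = trans (sym (distribˡ z x (y - x))) (cong (z *_) (x+[y-x]≡y x y))

  *-monoʳ-≤-nonNeg : ∀ {z} → 0ℝ ≤ z → ∀ {x y} → x ≤ y → x * z ≤ y * z
  *-monoʳ-≤-nonNeg {z} 0≤z {x} {y} x≤y =
    subst₂ _≤_ (*-comm z x) (*-comm z y) (*-monoˡ-≤-nonNeg 0≤z x≤y)

  *-mono-≤-nonNeg : ∀ {x y z w} → 0ℝ ≤ x → 0ℝ ≤ z → x ≤ y → z ≤ w → x * z ≤ y * w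
  *-mono-≤-nonNeg 0≤x 0≤z x≤y z≤w =
    ≤-trans (*-monoʳ-≤-nonNeg 0≤z x≤y) (*-monoˡ-≤-nonNeg (≤-trans 0≤x x≤y) z≤w)

  cube-mono-≤ : ∀ {x y} → 0ℝ ≤ x → x ≤ y → x * x * x ≤ y * y * y
  cube-mono-≤ 0≤x x≤y =
    *-mono-≤-nonNeg (*-nonneg _ _ 0≤x 0≤x) 0≤x (*-mono-≤-nonNeg 0≤x 0≤x x≤y x≤y) x≤y

  rearrangement : ∀ {x y z w} → x ≤ y → z ≤ w → x * w + y * z ≤ x * z + y * w
  rearrangement {x} {y} {z} {w} x≤y z≤w =
    subst (λ v → x * w + v * z ≤ x * z + v * w) (x+[y-x]≡y x y) (begin
      x * w + (x + d) * z    ≡⟨ expandˡ x d z w ⟩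
      x * w + x * z + d * z  ≤⟨ +-monoʳ-≤ (x * w + x * z) (*-monoˡ-≤-nonNeg 0≤d z≤w) ⟩
      x * w + x * z + d * w  ≡⟨ expandʳ x d z w ⟩
      x * z + (x + d) * w    ∎)
    where
    open ≤-Reasoning
    d : ℝ
    d = y - x
    0≤d : 0ℝ ≤ d
    0≤d = x≤y⇒0≤y-x x≤y
    expandˡ : ∀ x d z w → x * w + (x + d) * z ≡ x * w + x * z + d * z
    expandˡ = solve 4 (λ x d z w → x :* w :+ (x :+ d) :* z := x :* w :+ x :* z :+ d :* z) refl
    expandʳ : ∀ x d z w → x * w + x * z + d * w ≡ x * z + (x + d) * w
    expandʳ = solve 4 (λ x d z w → x :* w :+ x :* z :+ d :* w := x :* z :+ (x :+ d) :* w) refl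

  -x*-x≡x*x : ∀ x → - x * - x ≡ x * x
  -x*-x≡x*x x = begin
    - x * - x      ≡⟨ -‿distribˡ-* x (- x) ⟨
    - (x * - x)    ≡⟨ cong -_ (-‿distribʳ-* x x) ⟨
    - (- (x * x))  ≡⟨ ⁻¹-involutive (x * x) ⟩
    x * x          ∎
    where open ≡-Reasoning

  0≤x*x : ∀ x → 0ℝ ≤ x * x
  0≤x*x x with ≤-total 0ℝ x
  ... | inj₁ 0≤x = *-nonneg x x 0≤x 0≤x
  ... | inj₂ x≤0 = subst (0ℝ ≤_) (-x*-x≡x*x x) (*-nonneg (- x) (- x) 0≤-x 0≤-x)
    where
    0≤-x : 0ℝ ≤ - x
    0≤-x = subst (0ℝ ≤_) (+-identityˡ (- x)) (x≤y⇒0≤y-x x≤0)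

  0≤1 : 0ℝ ≤ 1ℝ
  0≤1 = subst (0ℝ ≤_) (*-identityˡ 1ℝ) (0≤x*x 1ℝ)

  0≤2 : 0ℝ ≤ 2ℝ
  0≤2 = ≤-trans 0≤1 (x≤x+y 0≤1)

  x*y≡0⇒y≡0 : ∀ {x y} → ¬ x ≡ 0ℝ → x * y ≡ 0ℝ → y ≡ 0ℝ
  x*y≡0⇒y≡0 {x} {y} x≢0 xy≡0 = begin
    y               ≡⟨ *-identityˡ y ⟨
    1ℝ * y          ≡⟨ cong (_* y) (trans (*-comm (x ⁻¹) x) (⁻¹-inverse x x≢0)) ⟨
    x ⁻¹ * x * y    ≡⟨ *-assoc (x ⁻¹) x y ⟩
    x ⁻¹ * (x * y)  ≡⟨ cong (x ⁻¹ *_) xy≡0 ⟩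
    x ⁻¹ * 0ℝ       ≡⟨ zeroʳ (x ⁻¹) ⟩
    0ℝ              ∎
    where open ≡-Reasoning

  x*x≡0⇒x≡0 : ∀ {x} → x * x ≡ 0ℝ → x ≡ 0ℝ
  x*x≡0⇒x≡0 {x} xx≡0 with x ≟ 0ℝ
  ... | yes x≡0 = x≡0
  ... | no  x≢0 = x*y≡0⇒y≡0 x≢0 xx≡0

  x*y≡1⇒x≢0 : ∀ {x y} → x * y ≡ 1ℝ → ¬ x ≡ 0ℝ
  x*y≡1⇒x≢0 {x} {y} xy≡1 x≡0 =
    0≢1 (trans (sym (zeroˡ y)) (trans (cong (_* y) (sym x≡0)) xy≡1))

  ⁻¹-unique : ∀ {x y} → x * y ≡ 1ℝ → x ⁻¹ ≡ y
  ⁻¹-unique {x} {y} xy≡1 = begin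
    x ⁻¹            ≡⟨ *-oneʳ (x ⁻¹) xy≡1 ⟨
    x ⁻¹ * (x * y)  ≡⟨ *-assoc (x ⁻¹) x y ⟨
    x ⁻¹ * x * y    ≡⟨ cong (_* y) (trans (*-comm (x ⁻¹) x) (⁻¹-inverse x (x*y≡1⇒x≢0 xy≡1))) ⟩
    1ℝ * y          ≡⟨ *-identityˡ y ⟩
    y               ∎
    where open ≡-Reasoning

  0<x⇒x≢0 : ∀ {x} → 0ℝ < x → ¬ x ≡ 0ℝ
  0<x⇒x≢0 (_ , 0≢x) x≡0 = 0≢x (sym x≡0)

  x*x⁻¹≡1 : ∀ {x} → 0ℝ < x → x * x ⁻¹ ≡ 1ℝ
  x*x⁻¹≡1 {x} 0<x = ⁻¹-inverse x (0<x⇒x≢0 0<x)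

  *-pos : ∀ {x y} → 0ℝ < x → 0ℝ < y → 0ℝ < x * y
  *-pos {x} {y} 0<x 0<y = *-nonneg x y (proj₁ 0<x) (proj₁ 0<y) ,
    λ 0≡xy → 0<x⇒x≢0 0<y (x*y≡0⇒y≡0 (0<x⇒x≢0 0<x) (sym 0≡xy))

  0<x⇒0<x⁻¹ : ∀ {x} → 0ℝ < x → 0ℝ < x ⁻¹
  0<x⇒0<x⁻¹ {x} 0<x =
    subst (0ℝ ≤_) x[x⁻¹x⁻¹]≡x⁻¹ (*-nonneg x _ (proj₁ 0<x) (0≤x*x (x ⁻¹))) ,
    λ 0≡x⁻¹ → 0≢1 (trans (sym (zeroʳ x)) (trans (cong (x *_) 0≡x⁻¹) (x*x⁻¹≡1 0<x)))
    where
    x[x⁻¹x⁻¹]≡x⁻¹ : x * (x ⁻¹ * x ⁻¹) ≡ x ⁻¹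
    x[x⁻¹x⁻¹]≡x⁻¹ = trans (sym (*-assoc x (x ⁻¹) (x ⁻¹)))
      (trans (cong (_* x ⁻¹) (x*x⁻¹≡1 0<x)) (*-identityˡ (x ⁻¹)))

  1≤x⇒0<x : ∀ {x} → 1ℝ ≤ x → 0ℝ < x
  1≤x⇒0<x 1≤x = ≤-trans 0≤1 1≤x , λ 0≡x → 0≢1 (≤-antisym 0≤1 (subst (1ℝ ≤_) (sym 0≡x) 1≤x))

  1≤x⇒x⁻¹≤1 : ∀ {x} → 1ℝ ≤ x → x ⁻¹ ≤ 1ℝ
  1≤x⇒x⁻¹≤1 {x} 1≤x = subst₂ _≤_ (*-identityʳ (x ⁻¹)) (trans (*-comm (x ⁻¹) x) (x*x⁻¹≡1 0<x))
    (*-monoˡ-≤-nonNeg (proj₁ (0<x⇒0<x⁻¹ 0<x)) 1≤x)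
    where 0<x = 1≤x⇒0<x 1≤x

  x²+y²≡2xy+[x-y]² : ∀ x y → x * x + y * y ≡ 2ℝ * (x * y) + (x - y) * (x - y)
  x²+y²≡2xy+[x-y]² x y = subst (λ z → z * z + y * y ≡ 2ℝ * (z * y) + (x - y) * (x - y))
    (x-y+y≡x x y) (expand (x - y) y)
    where
    expand : ∀ d y → (d + y) * (d + y) + y * y ≡ 2ℝ * ((d + y) * y) + d * d
    expand = solve 2 (λ d y → (d :+ y) :* (d :+ y) :+ y :* y := con 2 :* ((d :+ y) :* y) :+ d :* d) refl

  2xy≤x²+y² : ∀ x y → 2ℝ * (x * y) ≤ x * x + y * y
  2xy≤x²+y² x y = subst (2ℝ * (x * y) ≤_) (sym (x²+y²≡2xy+[x-y]² x y)) (x≤x+y (0≤x*x (x - y)))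

  x²+y²≤2xy⇒x≡y : ∀ {x y} → x * x + y * y ≤ 2ℝ * (x * y) → x ≡ y
  x²+y²≤2xy⇒x≡y {x} {y} le = begin
    x          ≡⟨ x-y+y≡x x y ⟨
    x - y + y  ≡⟨ cong (_+ y) (x*x≡0⇒x≡0 [x-y]²≡0) ⟩
    0ℝ + y     ≡⟨ +-identityˡ y ⟩
    y          ∎
    where
    open ≡-Reasoning
    [x-y]²≡0 : (x - y) * (x - y) ≡ 0ℝ
    [x-y]²≡0 = ≤-antisym
      (x+y≤x⇒y≤0 (subst (_≤ 2ℝ * (x * y)) (x²+y²≡2xy+[x-y]² x y) le)) (0≤x*x (x - y))

  ≤-inner⇒≤-norm : ∀ {a b x y} → a * a + b * b ≤ a * x + b * y → a * a + b * b ≤ x * x + y * y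
  ≤-inner⇒≤-norm {a} {b} {x} {y} le = +-cancelˡ-≤ (a * a + b * b) (begin
    (a * a + b * b) + (a * a + b * b)  ≤⟨ +-mono-≤₂ le le ⟩
    (a * x + b * y) + (a * x + b * y)  ≡⟨ [x+y]+[x+y]≡2x+2y (a * x) (b * y) ⟩
    2ℝ * (a * x) + 2ℝ * (b * y)        ≤⟨ +-mono-≤₂ (2xy≤x²+y² a x) (2xy≤x²+y² b y) ⟩
    (a * a + x * x) + (b * b + y * y)  ≡⟨ +-interchange (a * a) (x * x) (b * b) (y * y) ⟩
    (a * a + b * b) + (x * x + y * y)  ∎)
    where open ≤-Reasoning

  ≤-inner∧≥-norm⇒≡ : ∀ {a b x y} → a * a + b * b ≤ a * x + b * y →
                     x * x + y * y ≤ a * a + b * b → x ≡ a × y ≡ b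
  ≤-inner∧≥-norm⇒≡ {a} {b} {x} {y} le ge =
    sym (x²+y²≤2xy⇒x≡y (x+y≤u+v∧v≤y⇒x≤u squares≤2inner (2xy≤x²+y² b y))) ,
    sym (x²+y²≤2xy⇒x≡y (x+y≤u+v∧v≤y⇒x≤u
      (subst₂ _≤_ (+-comm _ _) (+-comm _ _) squares≤2inner) (2xy≤x²+y² a x)))
    where
    open ≤-Reasoning
    squares≤2inner : (a * a + x * x) + (b * b + y * y) ≤ 2ℝ * (a * x) + 2ℝ * (b * y)
    squares≤2inner = begin
      (a * a + x * x) + (b * b + y * y)  ≡⟨ +-interchange (a * a) (x * x) (b * b) (y * y) ⟩
      (a * a + b * b) + (x * x + y * y)  ≤⟨ +-monoʳ-≤ (a * a + b * b) ge ⟩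
      (a * a + b * b) + (a * a + b * b)  ≤⟨ +-mono-≤₂ le le ⟩
      (a * x + b * y) + (a * x + b * y)  ≡⟨ [x+y]+[x+y]≡2x+2y (a * x) (b * y) ⟩
      2ℝ * (a * x) + 2ℝ * (b * y)        ∎

module Program (R : RealField) where
  open RealField R
  open OrderedField R

  -- 1/x lies above its tangent line 2α − α²x at x = 1/α.
  reciprocal-tangent : ∀ {x} → 0ℝ < x → ∀ α → 2ℝ * α ≤ x ⁻¹ + x * (α * α)
  reciprocal-tangent {x} 0<x α =
    subst₂ _≤_ lhs rhs (*-monoˡ-≤-nonNeg (proj₁ (0<x⇒0<x⁻¹ 0<x)) (2xy≤x²+y² 1ℝ (x * α)))
    where
    lhs : x ⁻¹ * (2ℝ * (1ℝ * (x * α))) ≡ 2ℝ * α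
    lhs = trans (expand x (x ⁻¹) α) (*-oneʳ (2ℝ * α) (x*x⁻¹≡1 0<x))
      where
      expand : ∀ x i α → i * (2ℝ * (1ℝ * (x * α))) ≡ 2ℝ * α * (x * i)
      expand = solve 3 (λ x i α → i :* (con 2 :* (con 1 :* (x :* α))) := con 2 :* α :* (x :* i)) refl
    rhs : x ⁻¹ * (1ℝ * 1ℝ + x * α * (x * α)) ≡ x ⁻¹ + x * (α * α)
    rhs = trans (expand x (x ⁻¹) α) (cong (x ⁻¹ +_) (*-oneʳ (x * (α * α)) (x*x⁻¹≡1 0<x)))
      where
      expand : ∀ x i α → i * (1ℝ * 1ℝ + x * α * (x * α)) ≡ i + x * (α * α) * (x * i)
      expand = solve 3 (λ x i α →
        i :* (con 1 :* con 1 :+ x :* α :* (x :* α)) := i :+ x :* (α :* α) :* (x :* i)) refl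

  linearised-constraint : ∀ {s r} → 0ℝ < s → 0ℝ < r → ∀ {α β} →
    1ℝ / s + 2ℝ / r ≤ α + 2ℝ * β → α + 2ℝ * β ≤ s * (α * α) + 2ℝ * (r * (β * β))
  linearised-constraint {s} {r} 0<s 0<r {α} {β} constraint = +-cancelˡ-≤ (α + 2ℝ * β) (begin
    (α + 2ℝ * β) + (α + 2ℝ * β)                        ≡⟨ [x+y]+[x+y]≡2x+2y α (2ℝ * β) ⟩
    2ℝ * α + 2ℝ * (2ℝ * β)                             ≤⟨ +-mono-≤₂ (reciprocal-tangent 0<s α)
                                                             (*-monoˡ-≤-nonNeg 0≤2 (reciprocal-tangent 0<r β)) ⟩
    (s ⁻¹ + s * (α * α)) + 2ℝ * (r ⁻¹ + r * (β * β))  ≡⟨ regroup (s ⁻¹) _ (r ⁻¹) _ ⟩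
    (1ℝ / s + 2ℝ / r) + T                              ≤⟨ +-mono-≤ _ _ T constraint ⟩
    (α + 2ℝ * β) + T                                   ∎)
    where
    open ≤-Reasoning
    T : ℝ
    T = s * (α * α) + 2ℝ * (r * (β * β))
    regroup : ∀ u p v q → (u + p) + 2ℝ * (v + q) ≡ (1ℝ * u + 2ℝ * v) + (p + 2ℝ * q)
    regroup = solve 4 (λ u p v q →
      (u :+ p) :+ con 2 :* (v :+ q) := (con 1 :* u :+ con 2 :* v) :+ (p :+ con 2 :* q)) refl

  -- With λ = multiplier A B: at (A, B) the constraint 1/s + 2/r ≤ c has Lagrange multiplier
  -- 2A³ = λB², and the bound r ≤ B has multiplier 2(λ − B), nonnegative exactly when B³ ≤ 2A³.
  multiplier : ℝ → ℝ → ℝ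
  multiplier A B = 2ℝ * (A * A * A) * (B ⁻¹ * B ⁻¹)

  B≤multiplier : ∀ {A B} → 0ℝ < B → B * B * B ≤ 2ℝ * (A * A * A) → B ≤ multiplier A B
  B≤multiplier {A} {B} 0<B B³≤2A³ =
    subst (_≤ multiplier A B) B³β²≡B (*-monoʳ-≤-nonNeg (0≤x*x (B ⁻¹)) B³≤2A³)
    where
    expand : ∀ B β → B * B * B * (β * β) ≡ B * ((B * β) * (B * β))
    expand = solve 2 (λ B β → B :* B :* B :* (β :* β) := B :* ((B :* β) :* (B :* β))) refl
    B³β²≡B : B * B * B * (B ⁻¹ * B ⁻¹) ≡ B
    B³β²≡B = trans (expand B (B ⁻¹)) (*-oneʳ B (u≡1⇒u*u≡1 (x*x⁻¹≡1 0<B)))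

  lagrangian-bound : ∀ {A B s r} → 0ℝ < A → 0ℝ < B → 0ℝ < s → 0ℝ < r →
    1ℝ / s + 2ℝ / r ≤ 1ℝ / A + 2ℝ / B →
    A * A + multiplier A B * B ≤ A * s + multiplier A B * r
  lagrangian-bound {A} {B} {s} {r} 0<A 0<B 0<s 0<r constraint = subst₂ _≤_ cost-at-A gain-at-s
    (*-monoˡ-≤-nonNeg (proj₁ (*-pos (*-pos 0<A 0<A) 0<A)) (linearised-constraint 0<s 0<r constraint))
    where
    open ≡-Reasoning
    α β λ′ : ℝ
    α = 1ℝ / A
    β = B ⁻¹
    λ′ = multiplier A B
    cost-at-A : A * A * A * (α + 2ℝ * β) ≡ A * A + λ′ * B
    cost-at-A = begin
      A * A * A * (α + 2ℝ * β)                   ≡⟨ expand A (A ⁻¹) β ⟩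
      A * A * (A * A ⁻¹) + 2ℝ * (A * A * A) * β  ≡⟨ cong₂ _+_ (*-oneʳ (A * A) (x*x⁻¹≡1 0<A))
                                                         (sym (*-oneʳ _ (x*x⁻¹≡1 0<B))) ⟩
      A * A + 2ℝ * (A * A * A) * β * (B * β)     ≡⟨ cong (A * A +_) (regroup A B β) ⟩
      A * A + λ′ * B                             ∎
      where
      expand : ∀ A a β → A * A * A * (1ℝ * a + 2ℝ * β) ≡ A * A * (A * a) + 2ℝ * (A * A * A) * β
      expand = solve 3 (λ A a β →
        A :* A :* A :* (con 1 :* a :+ con 2 :* β) := A :* A :* (A :* a) :+ con 2 :* (A :* A :* A) :* β) refl
      regroup : ∀ A B β → 2ℝ * (A * A * A) * β * (B * β) ≡ 2ℝ * (A * A * A) * (β * β) * B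
      regroup = solve 3 (λ A B β →
        con 2 :* (A :* A :* A) :* β :* (B :* β) := con 2 :* (A :* A :* A) :* (β :* β) :* B) refl
    gain-at-s : A * A * A * (s * (α * α) + 2ℝ * (r * (β * β))) ≡ A * s + λ′ * r
    gain-at-s = trans (expand A s (A ⁻¹) r β)
      (cong (_+ λ′ * r) (*-oneʳ (A * s) (u≡1⇒u*u≡1 (x*x⁻¹≡1 0<A))))
      where
      expand : ∀ A s a r β → A * A * A * (s * ((1ℝ * a) * (1ℝ * a)) + 2ℝ * (r * (β * β)))
                              ≡ A * s * ((A * a) * (A * a)) + 2ℝ * (A * A * A) * (β * β) * r
      expand = solve 5 (λ A s a r β →
        A :* A :* A :* (s :* ((con 1 :* a) :* (con 1 :* a)) :+ con 2 :* (r :* (β :* β)))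
        := A :* s :* ((A :* a) :* (A :* a)) :+ con 2 :* (A :* A :* A) :* (β :* β) :* r) refl

  supporting-line : ∀ {A B s r} → 0ℝ < A → 0ℝ < B → B * B * B ≤ 2ℝ * (A * A * A) →
    0ℝ < s → 0ℝ < r → r ≤ B → 1ℝ / s + 2ℝ / r ≤ 1ℝ / A + 2ℝ / B →
    A * A + B * B ≤ A * s + B * r
  supporting-line {A} {B} {s} {r} 0<A 0<B B³≤2A³ 0<s 0<r r≤B constraint =
    +-cancelʳ-≤ (λ′ * B) (begin
      A * A + B * B + λ′ * B    ≡⟨ x+y+z≡x+z+y (A * A) (B * B) (λ′ * B) ⟩
      A * A + λ′ * B + B * B    ≤⟨ +-mono-≤ _ _ (B * B) (lagrangian-bound 0<A 0<B 0<s 0<r constraint) ⟩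
      A * s + λ′ * r + B * B    ≡⟨ x+y+z≡x+[z+y] (A * s) (λ′ * r) (B * B) ⟩
      A * s + (B * B + λ′ * r)  ≤⟨ +-monoʳ-≤ (A * s) (rearrangement (B≤multiplier 0<B B³≤2A³) r≤B) ⟩
      A * s + (B * r + λ′ * B)  ≡⟨ +-assoc (A * s) (B * r) (λ′ * B) ⟨
      A * s + B * r + λ′ * B    ∎)
    where
    open ≤-Reasoning
    λ′ : ℝ
    λ′ = multiplier A B

  unique-minimiser : ∀ {b c A} → Feasible b c A b → 1ℝ / A + 2ℝ / b ≡ c →
    b * b * b ≤ 2ℝ * (A * A * A) → IsUniqueMinimizer b c A b
  unique-minimiser {b} {c} {A} feasible@(0<A , 0<b , _) active b³≤2A³ =
    feasible ,
    (λ _ _ feasible′ → ≤-inner⇒≤-norm (supported feasible′)) ,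
    (λ _ _ feasible′ → ≤-inner∧≥-norm⇒≡ (supported feasible′))
    where
    supported : ∀ {s r} → Feasible b c s r → A * A + b * b ≤ A * s + b * r
    supported (0<s , 0<r , _ , r≤b , constraint) =
      supporting-line 0<A 0<b b³≤2A³ 0<s 0<r r≤b (subst (_ ≤_) (sym active) constraint)

  b/k≤b : ∀ {b k} → 0ℝ ≤ b → 1ℝ ≤ k → b / k ≤ b
  b/k≤b {b} 0≤b 1≤k = subst (b / _ ≤_) (*-identityʳ b) (*-monoˡ-≤-nonNeg 0≤b (1≤x⇒x⁻¹≤1 1≤k))

  1/[b/k]+2/b≡c : ∀ {b c k} → 0ℝ < b → 0ℝ < k → b * c ≡ k + 2ℝ → 1ℝ / (b / k) + 2ℝ / b ≡ c
  1/[b/k]+2/b≡c {b} {c} {k} 0<b 0<k bc≡k+2 = begin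
    1ℝ / (b / k) + 2ℝ * b ⁻¹  ≡⟨ cong (_+ 2ℝ * b ⁻¹) (trans (*-identityˡ _) [b/k]⁻¹≡k/b) ⟩
    k * b ⁻¹ + 2ℝ * b ⁻¹      ≡⟨ distribʳ (b ⁻¹) k 2ℝ ⟨
    (k + 2ℝ) * b ⁻¹           ≡⟨ cong (_* b ⁻¹) bc≡k+2 ⟨
    b * c * b ⁻¹              ≡⟨ x*y*z≡y*[x*z] b c (b ⁻¹) ⟩
    c * (b * b ⁻¹)            ≡⟨ *-oneʳ c (x*x⁻¹≡1 0<b) ⟩
    c                         ∎
    where
    open ≡-Reasoning
    regroup : ∀ b κ k β → b * κ * (k * β) ≡ (b * β) * (k * κ)
    regroup = solve 4 (λ b κ k β → b :* κ :* (k :* β) := (b :* β) :* (k :* κ)) refl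
    [b/k]⁻¹≡k/b : (b / k) ⁻¹ ≡ k * b ⁻¹
    [b/k]⁻¹≡k/b = ⁻¹-unique (trans (regroup b (k ⁻¹) k (b ⁻¹))
      (trans (cong₂ _*_ (x*x⁻¹≡1 0<b) (x*x⁻¹≡1 0<k)) (*-identityˡ 1ℝ)))

  b³≤2[b/k]³ : ∀ {b k} → 0ℝ < b → 0ℝ < k → k * k * k ≤ 2ℝ →
    b * b * b ≤ 2ℝ * ((b / k) * (b / k) * (b / k))
  b³≤2[b/k]³ {b} {k} 0<b 0<k k³≤2 = begin
    b * b * b                                  ≡⟨ *-oneʳ (b * b * b) (u≡1⇒u*u*u≡1 (x*x⁻¹≡1 0<k)) ⟨
    b * b * b * ((k * κ) * (k * κ) * (k * κ))  ≡⟨ regroup b k κ ⟩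
    A * A * A * (k * k * k)                    ≤⟨ *-monoˡ-≤-nonNeg 0≤A³ k³≤2 ⟩
    A * A * A * 2ℝ                             ≡⟨ *-comm (A * A * A) 2ℝ ⟩
    2ℝ * (A * A * A)                           ∎
    where
    open ≤-Reasoning
    κ A : ℝ
    κ = k ⁻¹
    A = b * κ
    0<A : 0ℝ < A
    0<A = *-pos 0<b (0<x⇒0<x⁻¹ 0<k)
    0≤A³ : 0ℝ ≤ A * A * A
    0≤A³ = proj₁ (*-pos (*-pos 0<A 0<A) 0<A)
    regroup : ∀ b k κ → b * b * b * ((k * κ) * (k * κ) * (k * κ))
                        ≡ (b * κ) * (b * κ) * (b * κ) * (k * k * k)
    regroup = solve 3 (λ b k κ → b :* b :* b :* ((k :* κ) :* (k :* κ) :* (k :* κ))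
                                 := (b :* κ) :* (b :* κ) :* (b :* κ) :* (k :* k :* k)) refl

lemma5 : (R : RealField) → let open RealField R in
    -- ∛2 : the (unique) real cube root of 2, and δ = 2 + ∛2
    (cbrt2 : ℝ) → cbrt2 * cbrt2 * cbrt2 ≡ 2ℝ →
    (b c : ℝ) → 0ℝ < b → 0ℝ < c →
    3ℝ ≤ c * b → c * b ≤ 2ℝ + cbrt2 →
    IsUniqueMinimizer b c (b / (b * c - 2ℝ)) b
lemma5 R cbrt2 cbrt2³≡2 b c 0<b _ 3≤cb cb≤2+cbrt2 =
  unique-minimiser (0<b/k , 0<b , b/k≤b (proj₁ 0<b) 1≤k , ≤-refl , ≤-reflexive active)
    active (b³≤2[b/k]³ 0<b 0<k k³≤2)
  where
  open RealField R
  open OrderedField R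
  open Program R
  k : ℝ
  k = b * c - 2ℝ
  cb-2≡k : c * b - 2ℝ ≡ k
  cb-2≡k = cong (_- 2ℝ) (*-comm c b)
  1≤k : 1ℝ ≤ k
  1≤k = subst₂ _≤_ (x+y-x≡y 2ℝ 1ℝ) cb-2≡k (+-mono-≤ _ _ (- 2ℝ) 3≤cb)
  0<k : 0ℝ < k
  0<k = 1≤x⇒0<x 1≤k
  k³≤2 : k * k * k ≤ 2ℝ
  k³≤2 = subst (k * k * k ≤_) cbrt2³≡2 (cube-mono-≤ (proj₁ 0<k)
    (subst₂ _≤_ cb-2≡k (x+y-x≡y 2ℝ cbrt2) (+-mono-≤ _ _ (- 2ℝ) cb≤2+cbrt2)))
  0<b/k : 0ℝ < b / k
  0<b/k = *-pos 0<b (0<x⇒0<x⁻¹ 0<k)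
  active : 1ℝ / (b / k) + 2ℝ / b ≡ c
  active = 1/[b/k]+2/b≡c 0<b 0<k (sym (x-y+y≡x (b * c) 2ℝ))
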